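{- Let $A\subseteq[n]$ be a set containing at most $3n$ Sidon 4-tuples. Then $|A|<\sqrt{6n}$.
   Context: $[n]=\{1,\dots,n\}$. A Sidon 4-tuple in a set $A$ of integers is an (ordered) 4-tuple $(a,b,c,d)$ of elements of $A$ with $a+b=c+d$ and $\{a,b\}\cap\{c,d\}=\emptyset$. -}

module Defs where

open import Data.Nat using (ℕ; _+_; _≤_; _≟_)
open import Data.List using (List; []; _∷_; length; filter; concatMap; map)
open import Data.Product using (_×_; _,_)
open import Data.Unit using (⊤)
open import Relation.Binary.PropositionalEquality using (_≡_; _≢_)
open import Relation.Nullary using (Dec; ¬?)
open import Relation.Nullary.Decidable using (_×-dec_)

quadruples : List ℕ → List (ℕ × ℕ × ℕ × ℕ)
quadruples A =
  concatMap (λ a → concatMap (λ b → concatMap (λ c → map (λ d → (a , b , c , d)) A) A) A) A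

IsSidon4 : ℕ × ℕ × ℕ × ℕ → Set
IsSidon4 (a , b , c , d) = (a + b ≡ c + d) × (a ≢ c) × (a ≢ d) × (b ≢ c) × (b ≢ d)

isSidon4? : (q : ℕ × ℕ × ℕ × ℕ) → Dec (IsSidon4 q)
isSidon4? (a , b , c , d) =
  (a + b ≟ c + d) ×-dec ¬? (a ≟ c) ×-dec ¬? (a ≟ d) ×-dec ¬? (b ≟ c) ×-dec ¬? (b ≟ d)

sidonCount : List ℕ → ℕ
sidonCount A = length (filter isSidon4? (quadruples A))

-- Let r(s) be the number of ordered pairs (c, d) ∈ A² with c + d = s, and E = Σ_s r(s)² the
-- additive energy of A, i.e. the number of (a, b, c, d) ∈ A⁴ with a + b = c + d.  Such a
-- quadruple is a Sidon 4-tuple unless c ∈ {a, b}, and for fixed (a, b) each of c = a, c = b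
-- allows at most one d, so E ≤ S + 2|A|², where S is the number of Sidon 4-tuples.  On the
-- other hand all sums lie in the 2n-element interval {2, …, 2n + 1}, over which Σ_s r(s) = |A|²,
-- and (r − 3)² ≥ 0 gives 6 r(s) ≤ r(s)² + 9, so 6|A|² ≤ E + 18n.  With S ≤ 3n this gives
-- 4|A|² ≤ 21n < 24n.
module Submission where

open import Defs
open import Data.Nat using (ℕ; _≤_; _<_; _*_)
open import Data.List using (List; length)
open import Data.List.Relation.Unary.All using (All)
open import Data.List.Relation.Unary.Unique.Propositional using (Unique)
open import Data.Product using (_×_)

open import Data.Nat using (zero; suc; _+_; z≤n; s≤s; _≟_; >-nonZero)
open import Data.Nat.Properties
open import Data.Nat.ListAction using (sum)
open import Data.Nat.ListAction.Properties using (sum-++)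
open import Data.List using ([]; _∷_; _++_; filter; map; concatMap)
open import Data.List.Properties using (map-++)
open import Data.List.Relation.Unary.All using ([]; _∷_)
import Data.List.Relation.Unary.All as All
open import Data.List.Relation.Unary.AllPairs using ([]; _∷_)
open import Data.Product using (_,_)
open import Data.Empty using (⊥-elim)
open import Function using (id)
open import Function.Definitions using (Injective)
open import Relation.Nullary using (Dec; yes; no; ¬_)
open import Relation.Unary using (Pred; Decidable)
open import Relation.Binary.PropositionalEquality
open import Data.Nat.Solver using (module +-*-Solver)
open +-*-Solver using (solve; _:=_; _:+_; _:*_; con)

private
  variable
    X Y : Set

∑ : List X → (X → ℕ) → ℕ
∑ xs f = sum (map f xs)

∑-cong : ∀ (xs : List X) {f g : X → ℕ} → (∀ x → f x ≡ g x) → ∑ xs f ≡ ∑ xs g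
∑-cong []       f≗g = refl
∑-cong (x ∷ xs) f≗g = cong₂ _+_ (f≗g x) (∑-cong xs f≗g)

∑-congᴬ : ∀ {xs : List X} {f g : X → ℕ} → All (λ x → f x ≡ g x) xs → ∑ xs f ≡ ∑ xs g
∑-congᴬ []           = refl
∑-congᴬ (fx≡gx ∷ eq) = cong₂ _+_ fx≡gx (∑-congᴬ eq)

∑-mono : ∀ (xs : List X) {f g : X → ℕ} → (∀ x → f x ≤ g x) → ∑ xs f ≤ ∑ xs g
∑-mono []       f≤g = z≤n
∑-mono (x ∷ xs) f≤g = +-mono-≤ (f≤g x) (∑-mono xs f≤g)

∑-const : ∀ (xs : List X) c → ∑ xs (λ _ → c) ≡ length xs * c
∑-const []       c = refl
∑-const (x ∷ xs) c = cong (c +_) (∑-const xs c)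

∑-zero : ∀ (xs : List X) → ∑ xs (λ _ → 0) ≡ 0
∑-zero []       = refl
∑-zero (x ∷ xs) = ∑-zero xs

∑-+ : ∀ (xs : List X) (f g : X → ℕ) → ∑ xs (λ x → f x + g x) ≡ ∑ xs f + ∑ xs g
∑-+ []       f g = refl
∑-+ (x ∷ xs) f g = begin
  f x + g x + ∑ xs (λ x → f x + g x) ≡⟨ cong (f x + g x +_) (∑-+ xs f g) ⟩
  f x + g x + (∑ xs f + ∑ xs g)       ≡⟨ solve 4 (λ a b c d → a :+ b :+ (c :+ d) := a :+ c :+ (b :+ d)) refl (f x) (g x) (∑ xs f) (∑ xs g) ⟩
  f x + ∑ xs f + (g x + ∑ xs g)       ∎
  where open ≡-Reasoning

∑-*ʳ : ∀ (xs : List X) (f : X → ℕ) c → ∑ xs (λ x → f x * c) ≡ ∑ xs f * c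
∑-*ʳ []       f c = refl
∑-*ʳ (x ∷ xs) f c = trans (cong (f x * c +_) (∑-*ʳ xs f c)) (sym (*-distribʳ-+ c (f x) (∑ xs f)))

∑-swap : ∀ (xs : List X) (ys : List Y) (f : X → Y → ℕ) →
         ∑ xs (λ x → ∑ ys (f x)) ≡ ∑ ys (λ y → ∑ xs (λ x → f x y))
∑-swap []       ys f = sym (∑-zero ys)
∑-swap (x ∷ xs) ys f =
  trans (cong (∑ ys (f x) +_) (∑-swap xs ys f)) (sym (∑-+ ys (f x) (λ y → ∑ xs (λ x′ → f x′ y))))

∑-map : ∀ (g : X → Y) (xs : List X) (f : Y → ℕ) → ∑ (map g xs) f ≡ ∑ xs (λ x → f (g x))
∑-map g []       f = refl
∑-map g (x ∷ xs) f = cong (f (g x) +_) (∑-map g xs f)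

∑-concatMap : ∀ (g : X → List Y) (xs : List X) (f : Y → ℕ) →
              ∑ (concatMap g xs) f ≡ ∑ xs (λ x → ∑ (g x) f)
∑-concatMap g []       f = refl
∑-concatMap g (x ∷ xs) f = begin
  sum (map f (g x ++ concatMap g xs))            ≡⟨ cong sum (map-++ f (g x) (concatMap g xs)) ⟩
  sum (map f (g x) ++ map f (concatMap g xs))    ≡⟨ sum-++ (map f (g x)) _ ⟩
  ∑ (g x) f + ∑ (concatMap g xs) f               ≡⟨ cong (∑ (g x) f +_) (∑-concatMap g xs f) ⟩
  ∑ (g x) f + ∑ xs (λ x → ∑ (g x) f)             ∎
  where open ≡-Reasoning

⟦_⟧ : {P : Set} → Dec P → ℕ
⟦ yes _ ⟧ = 1
⟦ no  _ ⟧ = 0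

⟦⟧-yes : {P : Set} → P → (p? : Dec P) → ⟦ p? ⟧ ≡ 1
⟦⟧-yes p (yes _) = refl
⟦⟧-yes p (no ¬p) = ⊥-elim (¬p p)

⟦⟧-no : {P : Set} → ¬ P → (p? : Dec P) → ⟦ p? ⟧ ≡ 0
⟦⟧-no ¬p (yes p) = ⊥-elim (¬p p)
⟦⟧-no ¬p (no _)  = refl

⟦⟧-mono : {P Q : Set} → (P → Q) → (p? : Dec P) (q? : Dec Q) → ⟦ p? ⟧ ≤ ⟦ q? ⟧
⟦⟧-mono P⇒Q (yes p) q? = ≤-reflexive (sym (⟦⟧-yes (P⇒Q p) q?))
⟦⟧-mono P⇒Q (no _)  q? = z≤n

length-filter≡∑ : ∀ {P : Pred X _} (P? : Decidable P) xs → length (filter P? xs) ≡ ∑ xs (λ x → ⟦ P? x ⟧)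
length-filter≡∑ P? []       = refl
length-filter≡∑ P? (x ∷ xs) with P? x
... | yes _ = cong suc (length-filter≡∑ P? xs)
... | no  _ = length-filter≡∑ P? xs

δ : ℕ → ℕ → ℕ
δ x s = ⟦ x ≟ s ⟧

δ-*-subst : ∀ x s (f : ℕ → ℕ) → δ x s * f s ≡ δ x s * f x
δ-*-subst x s f with x ≟ s
... | yes refl = refl
... | no  _    = refl

∑-δ-injective-≤1 : ∀ {xs : List X} → Unique xs → {g : X → ℕ} → Injective _≡_ _≡_ g →
                   ∀ s → ∑ xs (λ x → δ (g x) s) ≤ 1
∑-δ-injective-≤1 []                        inj s = z≤n
∑-δ-injective-≤1 {xs = x ∷ xs} (x∉xs ∷ u) {g} inj s with g x ≟ s
... | yes gx≡s = ≤-reflexive (cong suc (trans (∑-congᴬ (All.map δ≡0 x∉xs)) (∑-zero xs)))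
  where
  δ≡0 : ∀ {y} → ¬ x ≡ y → δ (g y) s ≡ 0
  δ≡0 x≢y = ⟦⟧-no (λ gy≡s → x≢y (inj (trans gx≡s (sym gy≡s)))) (g _ ≟ s)
... | no  _    = ∑-δ-injective-≤1 u inj s

interval : ℕ → ℕ → List ℕ
interval lo zero    = []
interval lo (suc m) = lo ∷ interval (suc lo) m

length-interval : ∀ lo m → length (interval lo m) ≡ m
length-interval lo zero    = refl
length-interval lo (suc m) = cong suc (length-interval (suc lo) m)

∑-δ-interval-below : ∀ {x} lo m → x < lo → ∑ (interval lo m) (δ x) ≡ 0
∑-δ-interval-below lo zero    x<lo = refl
∑-δ-interval-below lo (suc m) x<lo =
  cong₂ _+_ (⟦⟧-no (<⇒≢ x<lo) (_ ≟ lo)) (∑-δ-interval-below (suc lo) m (m<n⇒m<1+n x<lo))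

∑-δ-interval : ∀ {x} lo m → lo ≤ x → x < lo + m → ∑ (interval lo m) (δ x) ≡ 1
∑-δ-interval {x} lo zero    lo≤x x<lo+0 = ⊥-elim (<⇒≱ x<lo+0 (subst (_≤ x) (sym (+-identityʳ lo)) lo≤x))
∑-δ-interval {x} lo (suc m) lo≤x x<lo+m with x ≟ lo
... | yes x≡lo = cong suc (∑-δ-interval-below (suc lo) m (s≤s (≤-reflexive x≡lo)))
... | no  x≢lo = ∑-δ-interval (suc lo) m (≤∧≢⇒< lo≤x (≢-sym x≢lo)) (subst (x <_) (+-suc lo m) x<lo+m)

rep : List ℕ → ℕ → ℕ
rep A s = ∑ A (λ c → ∑ A (λ d → δ (c + d) s))

energy : List ℕ → ℕ
energy A = ∑ A (λ a → ∑ A (λ b → rep A (a + b)))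

SumsOnceIn : List ℕ → List ℕ → Set
SumsOnceIn A L = All (λ c → All (λ d → ∑ L (δ (c + d)) ≡ 1) A) A

∑-rep-* : ∀ {A} L → SumsOnceIn A L → (f : ℕ → ℕ) →
          ∑ L (λ s → rep A s * f s) ≡ ∑ A (λ c → ∑ A (λ d → f (c + d)))
∑-rep-* {A} L once f = begin
  ∑ L (λ s → rep A s * f s)
    ≡⟨ ∑-cong L (λ s → sym (∑-*ʳ A _ (f s))) ⟩
  ∑ L (λ s → ∑ A (λ c → ∑ A (λ d → δ (c + d) s) * f s))
    ≡⟨ ∑-cong L (λ s → ∑-cong A (λ c → sym (∑-*ʳ A _ (f s)))) ⟩
  ∑ L (λ s → ∑ A (λ c → ∑ A (λ d → δ (c + d) s * f s)))
    ≡⟨ ∑-cong L (λ s → ∑-cong A (λ c → ∑-cong A (λ d → δ-*-subst (c + d) s f))) ⟩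
  ∑ L (λ s → ∑ A (λ c → ∑ A (λ d → δ (c + d) s * f (c + d))))
    ≡⟨ ∑-swap L A _ ⟩
  ∑ A (λ c → ∑ L (λ s → ∑ A (λ d → δ (c + d) s * f (c + d))))
    ≡⟨ ∑-cong A (λ c → ∑-swap L A _) ⟩
  ∑ A (λ c → ∑ A (λ d → ∑ L (λ s → δ (c + d) s * f (c + d))))
    ≡⟨ ∑-cong A (λ c → ∑-cong A (λ d → ∑-*ʳ L (δ (c + d)) (f (c + d)))) ⟩
  ∑ A (λ c → ∑ A (λ d → ∑ L (δ (c + d)) * f (c + d)))
    ≡⟨ ∑-congᴬ (All.map (λ once-c → ∑-congᴬ (All.map (λ once-cd → cong (_* _) once-cd) once-c)) once) ⟩
  ∑ A (λ c → ∑ A (λ d → 1 * f (c + d)))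
    ≡⟨ ∑-cong A (λ c → ∑-cong A (λ d → *-identityˡ (f (c + d)))) ⟩
  ∑ A (λ c → ∑ A (λ d → f (c + d)))
    ∎
  where open ≡-Reasoning

∑-rep : ∀ {A} L → SumsOnceIn A L → ∑ L (rep A) ≡ length A * length A
∑-rep {A} L once = begin
  ∑ L (rep A)                    ≡⟨ ∑-cong L (λ s → sym (*-identityʳ (rep A s))) ⟩
  ∑ L (λ s → rep A s * 1)        ≡⟨ ∑-rep-* L once (λ _ → 1) ⟩
  ∑ A (λ c → ∑ A (λ d → 1))      ≡⟨ ∑-cong A (λ c → ∑-const A 1) ⟩
  ∑ A (λ c → length A * 1)       ≡⟨ ∑-const A _ ⟩
  length A * (length A * 1)      ≡⟨ cong (length A *_) (*-identityʳ (length A)) ⟩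
  length A * length A            ∎
  where open ≡-Reasoning

6*≤square+9 : ∀ r → 6 * r ≤ r * r + 9
6*≤square+9 0 = z≤n
6*≤square+9 1 = m≤m+n 6 4
6*≤square+9 2 = m≤m+n 12 1
6*≤square+9 3 = ≤-refl
6*≤square+9 4 = m≤m+n 24 1
6*≤square+9 5 = m≤m+n 30 4
6*≤square+9 r@(suc (suc (suc (suc (suc (suc _)))))) =
  ≤-trans (*-monoˡ-≤ r {6} {r} (s≤s (s≤s (s≤s (s≤s (s≤s (s≤s z≤n))))))) (m≤m+n (r * r) 9)

energy-lower : ∀ {A} L → SumsOnceIn A L → 6 * (length A * length A) ≤ energy A + length L * 9
energy-lower {A} L once = begin
  6 * (length A * length A)      ≡⟨ cong (6 *_) (∑-rep L once) ⟨
  6 * ∑ L (rep A)                ≡⟨ *-comm 6 (∑ L (rep A)) ⟩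
  ∑ L (rep A) * 6                ≡⟨ ∑-*ʳ L (rep A) 6 ⟨
  ∑ L (λ s → rep A s * 6)        ≤⟨ ∑-mono L (λ s → subst (_≤ rep A s * rep A s + 9) (*-comm 6 (rep A s)) (6*≤square+9 (rep A s))) ⟩
  ∑ L (λ s → rep A s * rep A s + 9)
    ≡⟨ ∑-+ L (λ s → rep A s * rep A s) (λ _ → 9) ⟩
  ∑ L (λ s → rep A s * rep A s) + ∑ L (λ _ → 9)
    ≡⟨ cong₂ _+_ (∑-rep-* L once (rep A)) (∑-const L 9) ⟩
  energy A + length L * 9        ∎
  where open ≤-Reasoning

sidonsWith₃ : List ℕ → ℕ → ℕ → ℕ → ℕ
sidonsWith₃ A a b c = ∑ A (λ d → ⟦ isSidon4? (a , b , c , d) ⟧)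

sidonsWith₂ : List ℕ → ℕ → ℕ → ℕ
sidonsWith₂ A a b = ∑ A (sidonsWith₃ A a b)

sidonCount≡∑ : ∀ A → sidonCount A ≡ ∑ A (λ a → ∑ A (sidonsWith₂ A a))
sidonCount≡∑ A =
  trans (length-filter≡∑ isSidon4? (quadruples A))
  (trans (∑-concatMap _ A _) (∑-cong A λ a →
  trans (∑-concatMap _ A _) (∑-cong A λ b →
  trans (∑-concatMap _ A _) (∑-cong A λ c →
  ∑-map _ A _))))

sameSum⇒isSidon4 : ∀ {a b c d} → c ≢ a → c ≢ b → c + d ≡ a + b → IsSidon4 (a , b , c , d)
sameSum⇒isSidon4 {a} {b} {c} {d} c≢a c≢b c+d≡a+b =
  sym c+d≡a+b , ≢-sym c≢a , a≢d , ≢-sym c≢b , b≢d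
  where
  a≢d : a ≢ d
  a≢d refl = c≢b (+-cancelʳ-≡ a c b (trans c+d≡a+b (+-comm a b)))
  b≢d : b ≢ d
  b≢d refl = c≢a (+-cancelʳ-≡ b c a c+d≡a+b)

∑-δ-+ˡ-≤1 : ∀ {A} → Unique A → ∀ c s → ∑ A (λ d → δ (c + d) s) ≤ 1
∑-δ-+ˡ-≤1 u c = ∑-δ-injective-≤1 u (λ {x} {y} → +-cancelˡ-≡ c x y)

rep-row≤ : ∀ {A} → Unique A → ∀ a b c →
           ∑ A (λ d → δ (c + d) (a + b)) ≤ sidonsWith₃ A a b c + (δ c a + δ c b)
rep-row≤ {A} u a b c with c ≟ a | c ≟ b
... | yes _   | _       = ≤-trans (∑-δ-+ˡ-≤1 u c (a + b)) (≤-trans (m≤m+n 1 _) (m≤n+m _ (sidonsWith₃ A a b c)))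
... | no _    | yes _   = ≤-trans (∑-δ-+ˡ-≤1 u c (a + b)) (m≤n+m 1 (sidonsWith₃ A a b c))
... | no c≢a  | no c≢b  =
  ≤-trans (∑-mono A (λ d → ⟦⟧-mono (sameSum⇒isSidon4 c≢a c≢b) (c + d ≟ a + b) (isSidon4? _))) (m≤m+n _ _)

rep-+≤ : ∀ {A} → Unique A → ∀ a b → rep A (a + b) ≤ sidonsWith₂ A a b + 2
rep-+≤ {A} u a b = begin
  rep A (a + b)
    ≤⟨ ∑-mono A (rep-row≤ u a b) ⟩
  ∑ A (λ c → sidonsWith₃ A a b c + (δ c a + δ c b))
    ≡⟨ ∑-+ A (sidonsWith₃ A a b) _ ⟩
  sidonsWith₂ A a b + ∑ A (λ c → δ c a + δ c b)
    ≡⟨ cong (sidonsWith₂ A a b +_) (∑-+ A (λ c → δ c a) (λ c → δ c b)) ⟩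
  sidonsWith₂ A a b + (∑ A (λ c → δ c a) + ∑ A (λ c → δ c b))
    ≤⟨ +-monoʳ-≤ (sidonsWith₂ A a b) (+-mono-≤ (∑-δ-injective-≤1 u {id} id a) (∑-δ-injective-≤1 u {id} id b)) ⟩
  sidonsWith₂ A a b + 2
    ∎
  where open ≤-Reasoning

energy-upper : ∀ {A} → Unique A → energy A ≤ sidonCount A + 2 * (length A * length A)
energy-upper {A} u = begin
  energy A
    ≤⟨ ∑-mono A (λ a → ∑-mono A (rep-+≤ u a)) ⟩
  ∑ A (λ a → ∑ A (λ b → sidonsWith₂ A a b + 2))
    ≡⟨ ∑-cong A (λ a → ∑-+ A (sidonsWith₂ A a) (λ _ → 2)) ⟩
  ∑ A (λ a → ∑ A (sidonsWith₂ A a) + ∑ A (λ _ → 2))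
    ≡⟨ ∑-+ A (λ a → ∑ A (sidonsWith₂ A a)) (λ _ → ∑ A (λ _ → 2)) ⟩
  ∑ A (λ a → ∑ A (sidonsWith₂ A a)) + ∑ A (λ _ → ∑ A (λ _ → 2))
    ≡⟨ cong₂ _+_ (sidonCount≡∑ A) (sym (trans (∑-cong A (λ _ → ∑-const A 2)) (∑-const A _))) ⟨
  sidonCount A + length A * (length A * 2)
    ≡⟨ cong (sidonCount A +_) (trans (sym (*-assoc (length A) (length A) 2)) (*-comm (length A * length A) 2)) ⟩
  sidonCount A + 2 * (length A * length A)
    ∎
  where open ≤-Reasoning

sumsOnceIn-interval : ∀ {n A} → All (λ x → 1 ≤ x × x ≤ n) A → SumsOnceIn A (interval 2 (n + n))
sumsOnceIn-interval {n} inRange = All.map (λ c∈ → All.map (once c∈) inRange) inRange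
  where
  once : ∀ {c d} → 1 ≤ c × c ≤ n → 1 ≤ d × d ≤ n → ∑ (interval 2 (n + n)) (δ (c + d)) ≡ 1
  once (1≤c , c≤n) (1≤d , d≤n) =
    ∑-δ-interval 2 (n + n) (+-mono-≤ 1≤c 1≤d) (s≤s (m≤n⇒m≤1+n (+-mono-≤ c≤n d≤n)))

<6*-from-energy-bounds : ∀ {n K E S} → 1 ≤ n → S ≤ 3 * n → E ≤ S + 2 * K → 6 * K ≤ E + (n + n) * 9 → K < 6 * n
<6*-from-energy-bounds {n} {K} {E} {S} 1≤n S≤3n E≤S+2K 6K≤E+18n = *-cancelˡ-< 4 K (6 * n) (begin-strict
  4 * K      ≤⟨ 4K≤21n ⟩
  21 * n     <⟨ *-monoˡ-< n {{>-nonZero 1≤n}} (m≤m+n 22 2) ⟩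
  24 * n     ≡⟨ *-assoc 4 6 n ⟩
  4 * (6 * n) ∎)
  where
  open ≤-Reasoning
  4K≤21n : 4 * K ≤ 21 * n
  4K≤21n = +-cancelʳ-≤ (2 * K) (4 * K) (21 * n) (begin
    4 * K + 2 * K          ≡⟨ solve 1 (λ K → con 4 :* K :+ con 2 :* K := con 6 :* K) refl K ⟩
    6 * K                  ≤⟨ 6K≤E+18n ⟩
    E + (n + n) * 9        ≤⟨ +-monoˡ-≤ ((n + n) * 9) (≤-trans E≤S+2K (+-monoˡ-≤ (2 * K) S≤3n)) ⟩
    3 * n + 2 * K + (n + n) * 9
                           ≡⟨ solve 2 (λ n K → con 3 :* n :+ con 2 :* K :+ (n :+ n) :* con 9 := con 21 :* n :+ con 2 :* K) refl n K ⟩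
    21 * n + 2 * K         ∎)

corollary2p2 : (n : ℕ) → 1 ≤ n → (A : List ℕ) → Unique A → All (λ x → 1 ≤ x × x ≤ n) A →
    sidonCount A ≤ 3 * n → length A * length A < 6 * n
corollary2p2 n 1≤n A unique inRange sidons≤3n =
  <6*-from-energy-bounds 1≤n sidons≤3n (energy-upper unique) energy≥
  where
  energy≥ : 6 * (length A * length A) ≤ energy A + (n + n) * 9
  energy≥ = subst (λ m → 6 * (length A * length A) ≤ energy A + m * 9) (length-interval 2 (n + n))
                  (energy-lower (interval 2 (n + n)) (sumsOnceIn-interval inRange))
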